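{- Let $m \geq 1$ and $0 \leq i \leq m$. Let $x$ be an irrational number with infinite continued fraction $[a_1,a_2,a_3,\dots]$ ($a_k$ positive integers), and let $x_n = [a_1,\dots,a_n]$ be its rational convergents. Expand each rational function $r^q_{i,m}(x_n)$ as a power series in $q$. Then: (a) if $n$ is even, the power series of $r^q_{i,m}(x_n)$ and $r^q_{i,m}(x_{n-1})$ agree up to the $q^{a_1+a_2+\cdots+a_n-1}$ term (their difference has no terms of degree less than $a_1+\cdots+a_n-1$); (b) if $n$ is odd, the power series of $r^q_{i,m}(x_n)$ and $r^q_{i,m}(x_{n-1})$ agree up to the $q^{a_1+a_2+\cdots+a_{n-1}-1}$ term (their difference has no terms of degree less than $a_1+\cdots+a_{n-1}-1$).
   Context: Border strip: for positive integers $a_1,\dots,a_n$, $\mathcal{G}[a_1,\dots,a_n]$ consists of unit boxes $b_1,\dots,b_N$, $N=a_1+\cdots+a_n-1$. If $n=1$ it is a vertical column of $a_1-1$ boxes indexed bottom to top. If $n\ge 2$, each $b_{t+1}$ is directly above or directly right of $b_t$, with step sequence: $a_1-1$ up, $a_2$ right, $a_3$ up, $a_4$ right, ..., alternating, ending with $a_n-1$ steps (right if $n$ even, up if $n$ odd). A $P$-partition with parts at most $m$ is a map $\sigma$ from boxes to $\{0,\dots,m\}$ weakly increasing along rows left to right and along columns top to bottom; its weight is the sum of its values. For $1\le i,j\le m+1$, $\Omega_m^{ij}(\mathcal{G},q) = \sum_\sigma q^{\mathrm{wt}(\sigma)}$ over such $\sigma$ with $\sigma(b_1)\le m+1-i$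 and $\sigma(b_N) \le m+1-j$. Higher $q$-continued fractions: for a rational $x \geq 1$ with continued fraction $x=[a_1,\dots,a_n]$ (positive integer entries; the shape $\mathcal{G}(x)=\mathcal{G}[a_1,\dots,a_n]$ does not depend on the choice of continued fraction expansion) and $0 \le i \le m$, \[ r^q_{i,m}(x) := \frac{\Omega_m^{m+1-i,1}(\mathcal{G}(x),q)}{\Omega_m^{m+1,1}(\mathcal{G}(x),q)}. \] (The denominator equals the generating function of $P$-partitions of the strip obtained by deleting the first column, and has constant term $1$; for $x = n$ an integer, $r^q_{i,m}(n) = \binom{n+i-1}{i}_q$.) -}

module Defs where

open import Data.Bool using (Bool; true; false; not; _∧_; _∨_; if_then_else_)
open import Data.Nat using (ℕ; zero; suc; _+_; _∸_; _≤ᵇ_; _≡ᵇ_)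
open import Data.List using (List; []; _∷_; _++_; replicate; map; concatMap; length; filter; upTo; zip)
open import Data.Nat.ListAction using (sum)
open import Data.Bool.ListAction using (all)
open import Data.Product using (_×_; _,_)
open import Data.Integer using (ℤ; +_) renaming (_+_ to _+ℤ_; _*_ to _*ℤ_; _-_ to _-ℤ_)
open import Relation.Nullary.Decidable using (Dec; yes; no)
open import Data.Bool.Properties using (T?)

-- Border strip G[a₁,…,aₙ] as the list of coordinates (column , row)
-- of its boxes b₁,…,b_N (N = a₁+⋯+aₙ − 1), b₁ placed at (0 , 0).

-- step directions: true = up, false = right
-- the tail after the initial up-run: entry with direction d,
-- full length except the last entry, which contributes (aₙ − 1).
tailSteps : Bool → List ℕ → List Bool
tailSteps d []            = []
tailSteps d (b ∷ [])      = replicate (b ∸ 1) d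
tailSteps d (b ∷ c ∷ rest) = replicate b d ++ tailSteps (not d) (c ∷ rest)

steps : List ℕ → List Bool
steps []            = []
steps (a ∷ [])      = replicate (a ∸ 2) true          -- n = 1: column of a₁−1 boxes
steps (a ∷ b ∷ rest) = replicate (a ∸ 1) true ++ tailSteps false (b ∷ rest)

walk : ℕ × ℕ → List Bool → List (ℕ × ℕ)
walk p       []          = p ∷ []
walk (x , y) (true ∷ ds)  = (x , y) ∷ walk (x , suc y) ds
walk (x , y) (false ∷ ds) = (x , y) ∷ walk (suc x , y) ds

boxes : List ℕ → List (ℕ × ℕ)
boxes as with sum as ∸ 1
... | zero  = []
... | suc _ = walk (0 , 0) (steps as)

-- P-partitions with parts ≤ m: a value list σ (σ(b_t) = t-th entry).

assignments : ℕ → ℕ → List (List ℕ)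
assignments m zero    = [] ∷ []
assignments m (suc n) = concatMap (λ v → map (v ∷_) (assignments m n)) (upTo (suc m))

-- weakly increasing along rows (left to right) and along columns (top to bottom)
pairOK : (ℕ × ℕ) × ℕ → (ℕ × ℕ) × ℕ → Bool
pairOK ((x₁ , y₁) , v₁) ((x₂ , y₂) , v₂) =
  (not ((y₁ ≡ᵇ y₂) ∧ (x₁ ≤ᵇ x₂)) ∨ (v₁ ≤ᵇ v₂)) ∧
  (not ((x₁ ≡ᵇ x₂) ∧ (y₂ ≤ᵇ y₁)) ∨ (v₁ ≤ᵇ v₂))

isPPartition : List (ℕ × ℕ) → List ℕ → Bool
isPPartition G σ = all (λ p → all (λ q → pairOK p q) L) L
  where L = zip G σ

firstLE : ℕ → List ℕ → Bool
firstLE B []      = true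
firstLE B (v ∷ _) = v ≤ᵇ B

lastLE : ℕ → List ℕ → Bool
lastLE B []          = true
lastLE B (v ∷ [])    = v ≤ᵇ B
lastLE B (_ ∷ w ∷ vs) = lastLE B (w ∷ vs)

-- coefficient of q^k in Ω_m^{IJ}(G(as), q)
Ωcoeff : (m I J : ℕ) → List ℕ → ℕ → ℕ
Ωcoeff m I J as k =
  length (filter (λ σ → T? (isPPartition G σ ∧ firstLE (suc m ∸ I) σ
                                ∧ lastLE (suc m ∸ J) σ ∧ (sum σ ≡ᵇ k)))
                 (assignments m (length G)))
  where G = boxes as

-- Power series expansion of P/Q where Q has constant term 1:
-- c₀ = P₀,  c_k = P_k − Σ_{j=1}^{k} Q_j c_{k−j}.

dot : ℕ → (ℕ → ℤ) → List ℤ → ℤ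
dot j Q []       = + 0
dot j Q (c ∷ cs) = (Q j *ℤ c) +ℤ dot (suc j) Q cs

-- seriesRev P Q k = c_k ∷ c_{k-1} ∷ … ∷ c₀ ∷ []
seriesRev : (ℕ → ℤ) → (ℕ → ℤ) → ℕ → List ℤ
seriesRev P Q zero    = P 0 ∷ []
seriesRev P Q (suc k) = (P (suc k) -ℤ dot 1 Q cs) ∷ cs
  where cs = seriesRev P Q k

seriesCoeff : (ℕ → ℤ) → (ℕ → ℤ) → ℕ → ℤ
seriesCoeff P Q k with seriesRev P Q k
... | []    = + 0
... | c ∷ _ = c

-- coefficient of q^k in the power series of
-- r^q_{i,m}(x) = Ω_m^{m+1-i,1}(G(x),q) / Ω_m^{m+1,1}(G(x),q),  x = [as]
rCoeff : (i m : ℕ) → List ℕ → ℕ → ℤ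
rCoeff i m as = seriesCoeff (λ k → + Ωcoeff m (suc m ∸ i) 1 as k)
                            (λ k → + Ωcoeff m (suc m) 1 as k)

-- the convergent x_n = [a₁,…,aₙ] of the sequence a (a₁ = a 0, a₂ = a 1, …)
convergent : (ℕ → ℕ) → ℕ → List ℕ
convergent a n = map a (upTo n)

-- Let F_ds(u) be the generating series of the chains of parts ≤ m that start with the part u
-- and follow the step sequence ds of a border strip (weakly decreasing along up steps,
-- weakly increasing along right steps).  The P-partitions counted by Ω^{I,1} are exactly
-- such chains with first part ≤ m + 1 − I, so r_{i,m}(x) = Σ_{u ≤ i} F_ds(u) / F_ds(0).
-- Passing from x_{n−1} to x_n appends steps X to the step sequence ds of G(x_{n−1}), and two
-- quotients P₁/Q₁, P₂/Q₂ with Q₁(0) = Q₂(0) = 1 agree modulo q^K as soon as Q₂P₁ ≡ Q₁P₂.  This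
-- reduces the theorem to the exchange relation F_{ds++X}(u) F_ds(0) ≡ F_ds(u) F_{ds++X}(0)
-- modulo q^K.  Peeling off the first step of ds gains one order, since for u ≠ v both sides of
-- F_{ds++X}(u) F_ds(v) ≡ F_ds(u) F_{ds++X}(v) carry the factor q^(u+v).  For ds empty the
-- relation holds modulo q, and modulo q^(a_n + 1) when G(x_{n−1}) ends with an up run (n even):
-- then X is an up step followed by a_n − 1 right steps, which cost weight ≥ a_n unless they
-- start from the part 0.

module Submission where

open import Defs
open import Data.Nat using (ℕ; _≤_; _<_; _∸_)
open import Data.Nat.DivMod using (_%_)
open import Data.Nat.ListAction using (sum)
open import Data.Product using (_×_)
open import Relation.Binary.PropositionalEquality using (_≡_)

open import Data.Bool using (Bool; true; false; not; T; if_then_else_; _∧_; _∨_)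
open import Data.Bool.Properties using (T?; T-∧; T-≡; ⇔→≡; ∧-zeroʳ; ∧-assoc; not-involutive)
open import Data.Empty using (⊥-elim)
open import Data.Integer using (ℤ; +_; 0ℤ; 1ℤ; _+_; _*_; _-_)
import Data.Integer.Properties as ℤ
open import Algebra.Properties.AbelianGroup ℤ.+-0-abelianGroup using () renaming (∙-cancelʳ to +-cancelʳ)
open import Data.Integer.Tactic.RingSolver using (solve-∀)
open import Data.List
  using (List; []; _∷_; _++_; _∷ʳ_; replicate; upTo; applyUpTo; zip; length; map; filter; concatMap)
open import Data.List.Properties
  using (filter-++; length-++; ++-assoc; length-replicate; length-map; length-upTo; map-upTo; applyUpTo-∷ʳ)
open import Data.List.Relation.Unary.All as All using (All; []; _∷_)
open import Data.List.Relation.Unary.All.Properties using (all⁺; all⁻; concat⁺; map⁺; applyUpTo⁺₁)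
open import Data.Nat as ℕ using (zero; suc; z≤n; s≤s; _≤ᵇ_; _<ᵇ_; _≡ᵇ_)
open import Data.Nat.ListAction.Properties using (sum-++)
import Data.Nat.Properties as ℕ
open import Data.Product using (_,_; proj₁; proj₂)
open import Data.Sum using (inj₁; inj₂)
open import Data.Unit using (tt)
open import Function using (_∘_)
open import Function.Bundles using (_⇔_; mk⇔; Equivalence)
import Function.Properties.Equivalence as ⇔
open import Relation.Binary.Bundles using (Setoid)
open import Relation.Binary.PropositionalEquality
  using (_≢_; refl; sym; trans; cong; cong₂; subst; _≗_; module ≡-Reasoning)
import Relation.Binary.Reasoning.Setoid as SetoidReasoning
open import Relation.Nullary using (yes; no)

-- Finite sums

Σ< : ℕ → (ℕ → ℤ) → ℤ
Σ< zero    f = 0ℤ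
Σ< (suc n) f = f 0 + Σ< n (f ∘ suc)

Σ<-cong : ∀ n {f g : ℕ → ℤ} → (∀ j → j < n → f j ≡ g j) → Σ< n f ≡ Σ< n g
Σ<-cong zero    f≡g = refl
Σ<-cong (suc n) f≡g = cong₂ _+_ (f≡g 0 ℕ.z<s) (Σ<-cong n (λ j j<n → f≡g (suc j) (s≤s j<n)))

Σ<-zero : ∀ n {f : ℕ → ℤ} → (∀ j → j < n → f j ≡ 0ℤ) → Σ< n f ≡ 0ℤ
Σ<-zero zero    f≡0 = refl
Σ<-zero (suc n) f≡0 = cong₂ _+_ (f≡0 0 ℕ.z<s) (Σ<-zero n (λ j j<n → f≡0 (suc j) (s≤s j<n)))

Σ<-snoc : ∀ n (f : ℕ → ℤ) → Σ< (suc n) f ≡ Σ< n f + f n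
Σ<-snoc zero    f = ℤ.+-comm (f 0) 0ℤ
Σ<-snoc (suc n) f = trans (cong (_+_ (f 0)) (Σ<-snoc n (f ∘ suc))) (sym (ℤ.+-assoc (f 0) _ _))

Σ<-+ : ∀ n (f g : ℕ → ℤ) → Σ< n (λ j → f j + g j) ≡ Σ< n f + Σ< n g
Σ<-+ zero    f g = refl
Σ<-+ (suc n) f g = trans (cong (_+_ (f 0 + g 0)) (Σ<-+ n (f ∘ suc) (g ∘ suc)))
                         (interchange (f 0) (g 0) _ _)
  where
  interchange : ∀ a b c d → (a + b) + (c + d) ≡ (a + c) + (b + d)
  interchange = solve-∀

Σ<-*ˡ : ∀ n c (f : ℕ → ℤ) → c * Σ< n f ≡ Σ< n (λ j → c * f j)
Σ<-*ˡ zero    c f = ℤ.*-zeroʳ c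
Σ<-*ˡ (suc n) c f = trans (ℤ.*-distribˡ-+ c (f 0) _) (cong (_+_ (c * f 0)) (Σ<-*ˡ n c (f ∘ suc)))

Σ<-swap : ∀ n p (f : ℕ → ℕ → ℤ) → Σ< n (λ i → Σ< p (f i)) ≡ Σ< p (λ j → Σ< n (λ i → f i j))
Σ<-swap zero    p f = sym (Σ<-zero p (λ _ _ → refl))
Σ<-swap (suc n) p f = trans (cong (_+_ (Σ< p (f 0))) (Σ<-swap n p (f ∘ suc)))
                            (sym (Σ<-+ p (f 0) (λ j → Σ< n (λ i → f (suc i) j))))

Σ<-reverse : ∀ n (f : ℕ → ℤ) → Σ< n f ≡ Σ< n (λ j → f (n ∸ suc j))
Σ<-reverse zero    f = refl
Σ<-reverse (suc n) f = begin
  f 0 + Σ< n (f ∘ suc)                      ≡⟨ cong (_+_ (f 0)) (Σ<-reverse n (f ∘ suc)) ⟩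
  f 0 + Σ< n (λ j → f (suc (n ∸ suc j)))    ≡⟨ cong (_+_ (f 0)) (Σ<-cong n (λ j j<n →
                                                 cong f (sym (ℕ.+-∸-assoc 1 j<n)))) ⟩
  f 0 + Σ< n (λ j → f (n ∸ j))              ≡⟨ ℤ.+-comm (f 0) _ ⟩
  Σ< n (λ j → f (n ∸ j)) + f 0              ≡⟨ cong (λ i → Σ< n (λ j → f (n ∸ j)) + f i) (ℕ.n∸n≡0 n) ⟨
  Σ< n (λ j → f (n ∸ j)) + f (n ∸ n)        ≡⟨ Σ<-snoc n (λ j → f (n ∸ j)) ⟨
  Σ< (suc n) (λ j → f (suc n ∸ suc j))      ∎
  where open ≡-Reasoning

Σ<-triangle : ∀ n (f : ℕ → ℕ → ℤ) →
              Σ< n (λ i → Σ< (n ∸ i) (f i)) ≡ Σ< n (λ j → Σ< (n ∸ j) (λ i → f i j))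
Σ<-triangle zero    f = refl
Σ<-triangle (suc n) f = begin
  Σ< (suc n) (f 0) + Σ< n (λ i → Σ< (n ∸ i) (f (suc i)))
    ≡⟨ cong (_+_ (Σ< (suc n) (f 0))) (Σ<-triangle n (f ∘ suc)) ⟩
  Σ< (suc n) (f 0) + Σ< n (λ j → Σ< (n ∸ j) (λ i → f (suc i) j))
    ≡⟨ cong (_+_ (Σ< (suc n) (f 0))) (extend-by-empty-column) ⟨
  Σ< (suc n) (f 0) + Σ< (suc n) (λ j → Σ< (n ∸ j) (λ i → f (suc i) j))
    ≡⟨ Σ<-+ (suc n) (f 0) (λ j → Σ< (n ∸ j) (λ i → f (suc i) j)) ⟨
  Σ< (suc n) (λ j → f 0 j + Σ< (n ∸ j) (λ i → f (suc i) j))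
    ≡⟨ Σ<-cong (suc n) (λ j j≤n → cong (λ l → Σ< l (λ i → f i j)) (ℕ.+-∸-assoc 1 (ℕ.s≤s⁻¹ j≤n))) ⟨
  Σ< (suc n) (λ j → Σ< (suc n ∸ j) (λ i → f i j))
    ∎
  where
  open ≡-Reasoning
  extend-by-empty-column : Σ< (suc n) (λ j → Σ< (n ∸ j) (λ i → f (suc i) j))
                         ≡ Σ< n (λ j → Σ< (n ∸ j) (λ i → f (suc i) j))
  extend-by-empty-column = begin
    Σ< (suc n) (λ j → Σ< (n ∸ j) (λ i → f (suc i) j))
      ≡⟨ Σ<-snoc n _ ⟩
    Σ< n (λ j → Σ< (n ∸ j) (λ i → f (suc i) j)) + Σ< (n ∸ n) (λ i → f (suc i) n)
      ≡⟨ cong (λ l → Σ< n (λ j → Σ< (n ∸ j) (λ i → f (suc i) j)) + Σ< l (λ i → f (suc i) n)) (ℕ.n∸n≡0 n) ⟩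
    Σ< n (λ j → Σ< (n ∸ j) (λ i → f (suc i) j)) + 0ℤ
      ≡⟨ ℤ.+-identityʳ _ ⟩
    Σ< n (λ j → Σ< (n ∸ j) (λ i → f (suc i) j))
      ∎

-- Formal power series

Series : Set
Series = ℕ → ℤ

infixl 7 _⊛_
_⊛_ : Series → Series → Series
(f ⊛ g) k = Σ< (suc k) (λ j → f j * g (k ∸ j))

q^_ : ℕ → Series
(q^ u) k = if u ≡ᵇ k then 1ℤ else 0ℤ

0ˢ : Series
0ˢ _ = 0ℤ

when : Bool → Series → Series
when b f k = if b then f k else 0ℤ

Σ<ˢ : ℕ → (ℕ → Series) → Series
Σ<ˢ n F k = Σ< n (λ w → F w k)

⊛-cong : ∀ {f f′ g g′} → f ≗ f′ → g ≗ g′ → f ⊛ g ≗ f′ ⊛ g′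
⊛-cong f≗f′ g≗g′ k = Σ<-cong (suc k) (λ j _ → cong₂ _*_ (f≗f′ j) (g≗g′ (k ∸ j)))

⊛-congʳ : ∀ f {g g′} → g ≗ g′ → f ⊛ g ≗ f ⊛ g′
⊛-congʳ f = ⊛-cong {f} (λ _ → refl)

⊛-comm : ∀ f g → f ⊛ g ≗ g ⊛ f
⊛-comm f g k = begin
  Σ< (suc k) (λ j → f j * g (k ∸ j))                 ≡⟨ Σ<-reverse (suc k) (λ j → f j * g (k ∸ j)) ⟩
  Σ< (suc k) (λ j → f (k ∸ j) * g (k ∸ (k ∸ j)))     ≡⟨ Σ<-cong (suc k) (λ j j<1+k →
      trans (cong (λ i → f (k ∸ j) * g i) (ℕ.m∸[m∸n]≡n (ℕ.s≤s⁻¹ j<1+k))) (ℤ.*-comm (f (k ∸ j)) (g j))) ⟩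
  Σ< (suc k) (λ j → g j * f (k ∸ j))                 ∎
  where open ≡-Reasoning

-- In this form, exchanging f and g is a reindexing of the triangular double sum.
⊛-⊛-triangle : ∀ f g h k → (f ⊛ (g ⊛ h)) k
             ≡ Σ< (suc k) (λ i → Σ< (suc k ∸ i) (λ j → f i * g j * h (k ∸ (i ℕ.+ j))))
⊛-⊛-triangle f g h k = Σ<-cong (suc k) (λ i i<1+k → begin
  f i * Σ< (suc (k ∸ i)) (λ j → g j * h (k ∸ i ∸ j))
    ≡⟨ Σ<-*ˡ (suc (k ∸ i)) (f i) (λ j → g j * h (k ∸ i ∸ j)) ⟩
  Σ< (suc (k ∸ i)) (λ j → f i * (g j * h (k ∸ i ∸ j)))
    ≡⟨ cong (λ l → Σ< l (λ j → f i * (g j * h (k ∸ i ∸ j)))) (ℕ.+-∸-assoc 1 (ℕ.s≤s⁻¹ i<1+k)) ⟨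
  Σ< (suc k ∸ i) (λ j → f i * (g j * h (k ∸ i ∸ j)))
    ≡⟨ Σ<-cong (suc k ∸ i) (λ j _ →
         trans (sym (ℤ.*-assoc (f i) (g j) _)) (cong (λ l → f i * g j * h l) (ℕ.∸-+-assoc k i j))) ⟩
  Σ< (suc k ∸ i) (λ j → f i * g j * h (k ∸ (i ℕ.+ j)))
    ∎)
  where open ≡-Reasoning

⊛-lcomm : ∀ f g h → f ⊛ (g ⊛ h) ≗ g ⊛ (f ⊛ h)
⊛-lcomm f g h k = begin
  (f ⊛ (g ⊛ h)) k
    ≡⟨ ⊛-⊛-triangle f g h k ⟩
  Σ< (suc k) (λ i → Σ< (suc k ∸ i) (λ j → f i * g j * h (k ∸ (i ℕ.+ j))))
    ≡⟨ Σ<-triangle (suc k) (λ i j → f i * g j * h (k ∸ (i ℕ.+ j))) ⟩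
  Σ< (suc k) (λ j → Σ< (suc k ∸ j) (λ i → f i * g j * h (k ∸ (i ℕ.+ j))))
    ≡⟨ Σ<-cong (suc k) (λ j _ → Σ<-cong (suc k ∸ j) (λ i _ →
         cong₂ _*_ (ℤ.*-comm (f i) (g j)) (cong (λ l → h (k ∸ l)) (ℕ.+-comm i j)))) ⟩
  Σ< (suc k) (λ j → Σ< (suc k ∸ j) (λ i → g j * f i * h (k ∸ (j ℕ.+ i))))
    ≡⟨ ⊛-⊛-triangle g f h k ⟨
  (g ⊛ (f ⊛ h)) k
    ∎
  where open ≡-Reasoning

⊛-assoc : ∀ f g h → (f ⊛ g) ⊛ h ≗ f ⊛ (g ⊛ h)
⊛-assoc f g h k = begin
  ((f ⊛ g) ⊛ h) k   ≡⟨ ⊛-comm (f ⊛ g) h k ⟩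
  (h ⊛ (f ⊛ g)) k   ≡⟨ ⊛-lcomm h f g k ⟩
  (f ⊛ (h ⊛ g)) k   ≡⟨ ⊛-congʳ f (⊛-comm h g) k ⟩
  (f ⊛ (g ⊛ h)) k   ∎
  where open ≡-Reasoning

⊛-zeroˡ : ∀ g → 0ˢ ⊛ g ≗ 0ˢ
⊛-zeroˡ g k = Σ<-zero (suc k) (λ j _ → ℤ.*-zeroˡ (g (k ∸ j)))

⊛-zeroʳ : ∀ f → f ⊛ 0ˢ ≗ 0ˢ
⊛-zeroʳ f k = trans (⊛-comm f 0ˢ k) (⊛-zeroˡ f k)

⊛-Σ<ˢ : ∀ n f (G : ℕ → Series) → f ⊛ Σ<ˢ n G ≗ Σ<ˢ n (λ w → f ⊛ G w)
⊛-Σ<ˢ n f G k = trans (Σ<-cong (suc k) (λ j _ → Σ<-*ˡ n (f j) (λ w → G w (k ∸ j))))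
                      (Σ<-swap (suc k) n (λ j w → f j * G w (k ∸ j)))

Σ<ˢ-⊛ : ∀ n (F : ℕ → Series) g → Σ<ˢ n F ⊛ g ≗ Σ<ˢ n (λ w → F w ⊛ g)
Σ<ˢ-⊛ n F g k = begin
  (Σ<ˢ n F ⊛ g) k                ≡⟨ ⊛-comm (Σ<ˢ n F) g k ⟩
  (g ⊛ Σ<ˢ n F) k                ≡⟨ ⊛-Σ<ˢ n g F k ⟩
  Σ< n (λ w → (g ⊛ F w) k)       ≡⟨ Σ<-cong n (λ w _ → ⊛-comm g (F w) k) ⟩
  Σ< n (λ w → (F w ⊛ g) k)       ∎
  where open ≡-Reasoning

⊛-interchange : ∀ a b c d → (a ⊛ b) ⊛ (c ⊛ d) ≗ a ⊛ (c ⊛ (b ⊛ d))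
⊛-interchange a b c d k =
  trans (⊛-assoc a b (c ⊛ d) k) (⊛-congʳ a (⊛-lcomm b c d) k)

q^suc-⊛-zero : ∀ u f → (q^ (suc u) ⊛ f) 0 ≡ 0ℤ
q^suc-⊛-zero u f = trans (ℤ.+-identityʳ _) (ℤ.*-zeroˡ (f 0))

q^suc-⊛-suc : ∀ u f k → (q^ (suc u) ⊛ f) (suc k) ≡ (q^ u ⊛ f) k
q^suc-⊛-suc u f k = trans (cong (_+ (q^ u ⊛ f) k) (ℤ.*-zeroˡ (f (suc k)))) (ℤ.+-identityˡ _)

q^-⊛ : ∀ u f k → (q^ u ⊛ f) k ≡ (if u <ᵇ suc k then f (k ∸ u) else 0ℤ)
q^-⊛ zero    f k       = begin
  1ℤ * f k + Σ< k (λ j → 0ℤ * f (k ∸ suc j))   ≡⟨ cong₂ _+_ (ℤ.*-identityˡ (f k))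
                                                       (Σ<-zero k (λ j _ → ℤ.*-zeroˡ (f (k ∸ suc j)))) ⟩
  f k + 0ℤ                                      ≡⟨ ℤ.+-identityʳ (f k) ⟩
  f k                                           ∎
  where open ≡-Reasoning
q^-⊛ (suc u) f zero    = q^suc-⊛-zero u f
q^-⊛ (suc u) f (suc k) = trans (q^suc-⊛-suc u f k) (q^-⊛ u f k)

q^0-⊛ : ∀ f → q^ 0 ⊛ f ≗ f
q^0-⊛ f = q^-⊛ 0 f

infix 4 _≈[_]_
_≈[_]_ : Series → ℕ → Series → Set
f ≈[ K ] g = ∀ k → k < K → f k ≡ g k

≈-sym : ∀ {f g K} → f ≈[ K ] g → g ≈[ K ] f
≈-sym f≈g k k<K = sym (f≈g k k<K)

≈-trans : ∀ {f g h K} → f ≈[ K ] g → g ≈[ K ] h → f ≈[ K ] h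
≈-trans f≈g g≈h k k<K = trans (f≈g k k<K) (g≈h k k<K)

≈-setoid : ℕ → Setoid _ _
≈-setoid K = record
  { Carrier       = Series
  ; _≈_           = _≈[ K ]_
  ; isEquivalence = record { refl = λ _ _ → refl ; sym = ≈-sym ; trans = ≈-trans }
  }

module ≈-Reasoning (K : ℕ) = SetoidReasoning (≈-setoid K)

≗⇒≈ : ∀ {f g} K → f ≗ g → f ≈[ K ] g
≗⇒≈ K f≗g k _ = f≗g k

≈-weaken : ∀ {f g K K′} → K ≤ K′ → f ≈[ K′ ] g → f ≈[ K ] g
≈-weaken K≤K′ f≈g k k<K = f≈g k (ℕ.<-≤-trans k<K K≤K′)

≈-zero : ∀ f g → f ≈[ 0 ] g
≈-zero f g k ()

Σ<ˢ-≈0 : ∀ {K} n (F : ℕ → Series) → (∀ w → w < n → F w ≈[ K ] 0ˢ) → Σ<ˢ n F ≈[ K ] 0ˢ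
Σ<ˢ-≈0 n F F≈0 k k<K = Σ<-zero n (λ w w<n → F≈0 w w<n k k<K)

Σ<ˢ-≈-head : ∀ {K} n (F : ℕ → Series) → (∀ w → w < n → F (suc w) ≈[ K ] 0ˢ) →
             Σ<ˢ (suc n) F ≈[ K ] F 0
Σ<ˢ-≈-head n F F≈0 k k<K =
  trans (cong (_+_ (F 0 k)) (Σ<ˢ-≈0 n (F ∘ suc) F≈0 k k<K)) (ℤ.+-identityʳ (F 0 k))

when-≈0 : ∀ {K} b f → (T b → f ≈[ K ] 0ˢ) → when b f ≈[ K ] 0ˢ
when-≈0 true  f f≈0 = f≈0 _
when-≈0 false f f≈0 k _ = refl

when-⊛-≈ : ∀ {K} b c f g f′ g′ → f ⊛ g ≈[ K ] f′ ⊛ g′ → when b f ⊛ when c g ≈[ K ] when b f′ ⊛ when c g′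
when-⊛-≈ true  true  f g f′ g′ fg≈f′g′     = fg≈f′g′
when-⊛-≈ true  false f g f′ g′ _       k _ = trans (⊛-zeroʳ f k) (sym (⊛-zeroʳ f′ k))
when-⊛-≈ false c     f g f′ g′ _       k _ = trans (⊛-zeroˡ (when c g) k) (sym (⊛-zeroˡ (when c g′) k))

Σ<ˢ-⊛-≈ : ∀ {K} n F F′ g g′ → (∀ w → F w ⊛ g ≈[ K ] F′ w ⊛ g′) → Σ<ˢ n F ⊛ g ≈[ K ] Σ<ˢ n F′ ⊛ g′
Σ<ˢ-⊛-≈ n F F′ g g′ F≈F′ k k<K = begin
  (Σ<ˢ n F ⊛ g) k             ≡⟨ Σ<ˢ-⊛ n F g k ⟩
  Σ< n (λ w → (F w ⊛ g) k)    ≡⟨ Σ<-cong n (λ w _ → F≈F′ w k k<K) ⟩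
  Σ< n (λ w → (F′ w ⊛ g′) k)  ≡⟨ Σ<ˢ-⊛ n F′ g′ k ⟨
  (Σ<ˢ n F′ ⊛ g′) k           ∎
  where open ≡-Reasoning

q^-⊛-≈ : ∀ s {K f g} → f ≈[ K ] g → q^ s ⊛ f ≈[ s ℕ.+ K ] q^ s ⊛ g
q^-⊛-≈ zero    {f = f} {g} f≈g k k<K = trans (q^0-⊛ f k) (trans (f≈g k k<K) (sym (q^0-⊛ g k)))
q^-⊛-≈ (suc s) {f = f} {g} f≈g zero    _ = trans (q^suc-⊛-zero s f) (sym (q^suc-⊛-zero s g))
q^-⊛-≈ (suc s) {f = f} {g} f≈g (suc k) (s≤s k<s+K) =
  trans (q^suc-⊛-suc s f k) (trans (q^-⊛-≈ s f≈g k k<s+K) (sym (q^suc-⊛-suc s g k)))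

≈-suc : ∀ {f g K} → f ≈[ K ] g → f K ≡ g K → f ≈[ suc K ] g
≈-suc f≈g fK≡gK k k<1+K with ℕ.m<1+n⇒m<n∨m≡n k<1+K
... | inj₁ k<K  = f≈g k k<K
... | inj₂ refl = fK≡gK

⊛-cancelˡ-≈ : ∀ {K f g} h → h 0 ≡ 1ℤ → h ⊛ f ≈[ K ] h ⊛ g → f ≈[ K ] g
⊛-cancelˡ-≈ {zero}          h h0≡1 hf≈hg k ()
⊛-cancelˡ-≈ {suc K} {f} {g} h h0≡1 hf≈hg = ≈-suc f≈g (begin
  f K           ≡⟨ ℤ.*-identityˡ (f K) ⟨
  1ℤ * f K      ≡⟨ cong (_* f K) h0≡1 ⟨
  h 0 * f K     ≡⟨ +-cancelʳ tail (h 0 * f K) (h 0 * g K) (begin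
      h 0 * f K + tail
        ≡⟨ cong (_+_ (h 0 * f K)) (Σ<-cong K (λ j j<K →
             cong (h (suc j) *_) (f≈g (K ∸ suc j) (ℕ.∸-monoʳ-< ℕ.z<s j<K)))) ⟨
      h 0 * f K + Σ< K (λ j → h (suc j) * f (K ∸ suc j))
        ≡⟨ hf≈hg K ℕ.≤-refl ⟩
      h 0 * g K + tail
        ∎) ⟩
  h 0 * g K     ≡⟨ cong (_* g K) h0≡1 ⟩
  1ℤ * g K      ≡⟨ ℤ.*-identityˡ (g K) ⟩
  g K           ∎)
  where
  open ≡-Reasoning
  f≈g : f ≈[ K ] g
  f≈g = ⊛-cancelˡ-≈ h h0≡1 (≈-weaken (ℕ.n≤1+n K) hf≈hg)
  tail = Σ< K (λ j → h (suc j) * g (K ∸ suc j))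

dot-seriesRev : ∀ P Q k s →
  dot s Q (seriesRev P Q k) ≡ Σ< (suc k) (λ j → Q (s ℕ.+ j) * seriesCoeff P Q (k ∸ j))
dot-seriesRev P Q zero    s = cong (λ i → Q i * P 0 + 0ℤ) (sym (ℕ.+-identityʳ s))
dot-seriesRev P Q (suc k) s = cong₂ _+_
  (cong (λ i → Q i * seriesCoeff P Q (suc k)) (sym (ℕ.+-identityʳ s)))
  (trans (dot-seriesRev P Q k (suc s))
         (Σ<-cong (suc k) (λ j _ → cong (λ i → Q i * seriesCoeff P Q (k ∸ j)) (sym (ℕ.+-suc s j)))))

⊛-seriesCoeff : ∀ P Q → Q 0 ≡ 1ℤ → Q ⊛ seriesCoeff P Q ≗ P
⊛-seriesCoeff P Q Q0≡1 zero    = trans (ℤ.+-identityʳ _) (trans (cong (_* P 0) Q0≡1) (ℤ.*-identityˡ (P 0)))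
⊛-seriesCoeff P Q Q0≡1 (suc k) = begin
  Q 0 * (P (suc k) - D) + Σ< (suc k) (λ j → Q (suc j) * seriesCoeff P Q (k ∸ j))
    ≡⟨ cong₂ _+_ (trans (cong (_* (P (suc k) - D)) Q0≡1) (ℤ.*-identityˡ _)) (sym (dot-seriesRev P Q k 1)) ⟩
  (P (suc k) - D) + D
    ≡⟨ minus-plus (P (suc k)) D ⟩
  P (suc k)
    ∎
  where
  open ≡-Reasoning
  D = dot 1 Q (seriesRev P Q k)
  minus-plus : ∀ a b → (a - b) + b ≡ a
  minus-plus = solve-∀

seriesCoeff-≈ : ∀ {K} P₁ Q₁ P₂ Q₂ → Q₁ 0 ≡ 1ℤ → Q₂ 0 ≡ 1ℤ → Q₂ ⊛ P₁ ≈[ K ] Q₁ ⊛ P₂ →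
                seriesCoeff P₁ Q₁ ≈[ K ] seriesCoeff P₂ Q₂
seriesCoeff-≈ {K} P₁ Q₁ P₂ Q₂ Q₁0≡1 Q₂0≡1 cross = ⊛-cancelˡ-≈ (Q₁ ⊛ Q₂) Q₁Q₂0≡1 (begin
  (Q₁ ⊛ Q₂) ⊛ c₁   ≈⟨ ≗⇒≈ K (λ k → trans (⊛-assoc Q₁ Q₂ c₁ k) (⊛-lcomm Q₁ Q₂ c₁ k)) ⟩
  Q₂ ⊛ (Q₁ ⊛ c₁)   ≈⟨ ≗⇒≈ K (⊛-congʳ Q₂ (⊛-seriesCoeff P₁ Q₁ Q₁0≡1)) ⟩
  Q₂ ⊛ P₁          ≈⟨ cross ⟩
  Q₁ ⊛ P₂          ≈⟨ ≗⇒≈ K (⊛-congʳ Q₁ (⊛-seriesCoeff P₂ Q₂ Q₂0≡1)) ⟨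
  Q₁ ⊛ (Q₂ ⊛ c₂)   ≈⟨ ≗⇒≈ K (⊛-assoc Q₁ Q₂ c₂) ⟨
  (Q₁ ⊛ Q₂) ⊛ c₂   ∎)
  where
  open ≈-Reasoning K
  c₁ = seriesCoeff P₁ Q₁
  c₂ = seriesCoeff P₂ Q₂
  Q₁Q₂0≡1 : (Q₁ ⊛ Q₂) 0 ≡ 1ℤ
  Q₁Q₂0≡1 = trans (ℤ.+-identityʳ _) (cong₂ _*_ Q₁0≡1 Q₂0≡1)

-- Border strips and chains

stepOK : Bool → ℕ → ℕ → Bool
stepOK true  u w = w ≤ᵇ u
stepOK false u w = u ≤ᵇ w

isChain : List Bool → List ℕ → Bool
isChain []       _           = true
isChain (d ∷ ds) (u ∷ w ∷ τ) = stepOK d u w ∧ isChain ds (w ∷ τ)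
isChain (_ ∷ _)  _           = false

Cell : Set
Cell = (ℕ × ℕ) × ℕ

Monotone : List Cell → Set
Monotone L = All (λ a → All (λ b → T (pairOK a b)) L) L

Compatible : Cell → List Cell → Set
Compatible c L = All (λ b → T (pairOK c b) × T (pairOK b c)) L

T-isPPartition : ∀ G σ → T (isPPartition G σ) ⇔ Monotone (zip G σ)
T-isPPartition G σ = mk⇔
  (λ t → All.map (all⁺ _ L) (all⁺ _ L t))
  (λ monotone → all⁻ _ (All.map (all⁻ _) monotone))
  where L = zip G σ

T-⇒ : ∀ {b c} → T (not b ∨ c) ⇔ (T b → T c)
T-⇒ {true}  = mk⇔ (λ t _ → t) (λ f → f tt)
T-⇒ {false} = mk⇔ (λ _ ()) (λ _ → tt)

Ordered : Cell → Cell → Set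
Ordered ((x₁ , y₁) , v₁) ((x₂ , y₂) , v₂) =
  (y₁ ≡ y₂ → x₁ ≤ x₂ → v₁ ≤ v₂) × (x₁ ≡ x₂ → y₂ ≤ y₁ → v₁ ≤ v₂)

T-pairOK : ∀ c c′ → T (pairOK c c′) ⇔ Ordered c c′
T-pairOK ((x₁ , y₁) , v₁) ((x₂ , y₂) , v₂) = mk⇔
  (λ t → let row , col = Equivalence.to T-∧ t in
     (λ e l → ℕ.≤ᵇ⇒≤ v₁ v₂ (Equivalence.to T-⇒ row (Equivalence.from T-∧ (ℕ.≡⇒≡ᵇ y₁ y₂ e , ℕ.≤⇒≤ᵇ l))))
   , (λ e l → ℕ.≤ᵇ⇒≤ v₁ v₂ (Equivalence.to T-⇒ col (Equivalence.from T-∧ (ℕ.≡⇒≡ᵇ x₁ x₂ e , ℕ.≤⇒≤ᵇ l)))))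
  (λ (row , col) → Equivalence.from T-∧
     ( Equivalence.from T-⇒ (λ t → let e , l = Equivalence.to T-∧ t in
         ℕ.≤⇒≤ᵇ (row (ℕ.≡ᵇ⇒≡ y₁ y₂ e) (ℕ.≤ᵇ⇒≤ x₁ x₂ l)))
     , Equivalence.from T-⇒ (λ t → let e , l = Equivalence.to T-∧ t in
         ℕ.≤⇒≤ᵇ (col (ℕ.≡ᵇ⇒≡ x₁ x₂ e) (ℕ.≤ᵇ⇒≤ y₂ y₁ l)))))

pairOK-refl : ∀ c → T (pairOK c c)
pairOK-refl c@((_ , _) , _) = Equivalence.from (T-pairOK c c) ((λ _ _ → ℕ.≤-refl) , (λ _ _ → ℕ.≤-refl))

Monotone-∷⇔ : ∀ {c L} {A B : Set} → (Monotone L → Compatible c L ⇔ A) → Monotone L ⇔ B →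
              Monotone (c ∷ L) ⇔ (A × B)
Monotone-∷⇔ {c} {L} compatible⇔ monotone⇔ = mk⇔
  (λ { ((_ ∷ row) ∷ rest) → let m = All.map All.tail rest in
         Equivalence.to (compatible⇔ m) (All.zipWith (λ p → p) (row , All.map All.head rest))
       , Equivalence.to monotone⇔ m })
  (λ (a , b) → let m = Equivalence.from monotone⇔ b
                   compatible = Equivalence.from (compatible⇔ m) a in
     (pairOK-refl c ∷ All.map proj₁ compatible) ∷ All.zipWith (λ (cb , mb) → proj₂ cb ∷ mb) (compatible , m))

T-injective : ∀ {x y} → T x ⇔ T y → x ≡ y
T-injective T-x⇔T-y = ⇔→≡ (⇔.trans (⇔.sym T-≡) (⇔.trans T-x⇔T-y T-≡))

walk-≥ : ∀ {a b} x y ds → a ≤ x → b ≤ y → All (λ p → a ≤ proj₁ p × b ≤ proj₂ p) (walk (x , y) ds)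
walk-≥ x y []           a≤x b≤y = (a≤x , b≤y) ∷ []
walk-≥ x y (true  ∷ ds) a≤x b≤y = (a≤x , b≤y) ∷ walk-≥ x (suc y) ds a≤x (ℕ.m≤n⇒m≤1+n b≤y)
walk-≥ x y (false ∷ ds) a≤x b≤y = (a≤x , b≤y) ∷ walk-≥ (suc x) y ds (ℕ.m≤n⇒m≤1+n a≤x) b≤y

All-zip⁺ : ∀ {P : ℕ × ℕ → Set} ps (vs : List ℕ) → All P ps → All (P ∘ proj₁) (zip ps vs)
All-zip⁺ []       vs       _          = []
All-zip⁺ (p ∷ ps) []       _          = []
All-zip⁺ (p ∷ ps) (v ∷ vs) (Pp ∷ Pps) = Pp ∷ All-zip⁺ ps vs Pps

All-zip-walk-head : ∀ {P : Cell → Set} x y ds v σ → All P (zip (walk (x , y) ds) (v ∷ σ)) → P ((x , y) , v)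
All-zip-walk-head x y []          v σ (Pc ∷ _) = Pc
All-zip-walk-head x y (true ∷ _)  v σ (Pc ∷ _) = Pc
All-zip-walk-head x y (false ∷ _) v σ (Pc ∷ _) = Pc

-- A right step (up step) from c leads into a strip lying weakly above and strictly to the
-- right of c (strictly above and weakly to the right), so c shares a row (column) only
-- with cells that can be compared with c through the next cell.
right-step-Compatible : ∀ x y v v′ ds σ → let L = zip (walk (suc x , y) ds) (v′ ∷ σ) in
                        Monotone L → Compatible ((x , y) , v) L ⇔ T (stepOK false v v′)
right-step-Compatible x y v v′ ds σ monotone = mk⇔
  (λ compatible → ℕ.≤⇒≤ᵇ (proj₁ (Equivalence.to (T-pairOK c next)
     (proj₁ (All-zip-walk-head (suc x) y ds v′ σ compatible))) refl (ℕ.n≤1+n x)))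
  (λ t → All.zipWith (λ (position , ordered) → compatible (ℕ.≤ᵇ⇒≤ v v′ t) _ position ordered)
     (All-zip⁺ _ (v′ ∷ σ) (walk-≥ (suc x) y ds ℕ.≤-refl ℕ.≤-refl) ,
      All-zip-walk-head (suc x) y ds v′ σ monotone))
  where
  c = ((x , y) , v)
  next = ((suc x , y) , v′)
  compatible : v ≤ v′ → ∀ b → suc x ≤ proj₁ (proj₁ b) × y ≤ proj₂ (proj₁ b) →
               T (pairOK next b) → T (pairOK c b) × T (pairOK b c)
  compatible v≤v′ b@((x′ , y′) , w) (x<x′ , _) t =
      Equivalence.from (T-pairOK c b)
        ( (λ e _ → ℕ.≤-trans v≤v′ (proj₁ (Equivalence.to (T-pairOK next b) t) e x<x′))
        , (λ e _ → ⊥-elim (ℕ.<⇒≢ x<x′ e)))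
    , Equivalence.from (T-pairOK b c)
        ( (λ _ l → ⊥-elim (ℕ.<⇒≱ x<x′ l))
        , (λ e _ → ⊥-elim (ℕ.<⇒≢ x<x′ (sym e))))

up-step-Compatible : ∀ x y v v′ ds σ → let L = zip (walk (x , suc y) ds) (v′ ∷ σ) in
                     Monotone L → Compatible ((x , y) , v) L ⇔ T (stepOK true v v′)
up-step-Compatible x y v v′ ds σ monotone = mk⇔
  (λ compatible → ℕ.≤⇒≤ᵇ (proj₂ (Equivalence.to (T-pairOK next c)
     (proj₂ (All-zip-walk-head x (suc y) ds v′ σ compatible))) refl (ℕ.n≤1+n y)))
  (λ t → All.zipWith (λ (position , ordered) → compatible (ℕ.≤ᵇ⇒≤ v′ v t) _ position ordered)
     (All-zip⁺ _ (v′ ∷ σ) (walk-≥ x (suc y) ds ℕ.≤-refl ℕ.≤-refl) ,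
      All.map (All-zip-walk-head x (suc y) ds v′ σ) monotone))
  where
  c = ((x , y) , v)
  next = ((x , suc y) , v′)
  compatible : v′ ≤ v → ∀ b → x ≤ proj₁ (proj₁ b) × suc y ≤ proj₂ (proj₁ b) →
               T (pairOK b next) → T (pairOK c b) × T (pairOK b c)
  compatible v′≤v b@((x′ , y′) , w) (_ , y<y′) t =
      Equivalence.from (T-pairOK c b)
        ( (λ e _ → ⊥-elim (ℕ.<⇒≢ y<y′ e))
        , (λ _ l → ⊥-elim (ℕ.<⇒≱ y<y′ l)))
    , Equivalence.from (T-pairOK b c)
        ( (λ e _ → ⊥-elim (ℕ.<⇒≢ y<y′ (sym e)))
        , (λ e _ → ℕ.≤-trans (proj₂ (Equivalence.to (T-pairOK b next) t) e y<y′) v′≤v))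

Monotone-walk⇔ : ∀ x y ds σ → length σ ≡ suc (length ds) →
                 Monotone (zip (walk (x , y) ds) σ) ⇔ T (isChain ds σ)
Monotone-walk⇔ x y []           (v ∷ [])     _   =
  mk⇔ (λ _ → tt) (λ _ → (pairOK-refl ((x , y) , v) ∷ []) ∷ [])
Monotone-walk⇔ x y (false ∷ ds) (v ∷ v′ ∷ σ) len = ⇔.trans
  (Monotone-∷⇔ (right-step-Compatible x y v v′ ds σ)
               (Monotone-walk⇔ (suc x) y ds (v′ ∷ σ) (ℕ.suc-injective len)))
  (⇔.sym T-∧)
Monotone-walk⇔ x y (true ∷ ds)  (v ∷ v′ ∷ σ) len = ⇔.trans
  (Monotone-∷⇔ (up-step-Compatible x y v v′ ds σ)
               (Monotone-walk⇔ x (suc y) ds (v′ ∷ σ) (ℕ.suc-injective len)))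
  (⇔.sym T-∧)

isPPartition-walk : ∀ x y ds σ → length σ ≡ suc (length ds) →
                    isPPartition (walk (x , y) ds) σ ≡ isChain ds σ
isPPartition-walk x y ds σ len =
  T-injective (⇔.trans (T-isPPartition (walk (x , y) ds) σ) (Monotone-walk⇔ x y ds σ len))

nextSum : ℕ → Bool → ℕ → (ℕ → Series) → Series
nextSum m d u f = Σ<ˢ (suc m) (λ w → when (stepOK d u w) (f w))

-- The series F_ds(u): chains u ∷ τ with parts ≤ m following the steps ds, weighted by their sum.
chainSeries : ℕ → List Bool → ℕ → Series
chainSeries m []       u = q^ u
chainSeries m (d ∷ ds) u = q^ u ⊛ nextSum m d u (chainSeries m ds)

count : (List ℕ → Bool) → List (List ℕ) → ℕ
count p σs = length (filter (T? ∘ p) σs)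

count-++ : ∀ p σs σs′ → count p (σs ++ σs′) ≡ count p σs ℕ.+ count p σs′
count-++ p σs σs′ = trans (cong length (filter-++ (T? ∘ p) σs σs′)) (length-++ (filter (T? ∘ p) σs))

count-map : ∀ p f σs → count p (map f σs) ≡ count (p ∘ f) σs
count-map p f []       = refl
count-map p f (σ ∷ σs) with p (f σ)
... | true  = cong suc (count-map p f σs)
... | false = count-map p f σs

count-cong : ∀ {p p′ σs} → All (λ σ → p σ ≡ p′ σ) σs → count p σs ≡ count p′ σs
count-cong                  []      = refl
count-cong {p} {p′} {σ ∷ _} (_ ∷ _) with p σ | p′ σ
count-cong (refl ∷ ps≡p′s) | true  | true  = cong suc (count-cong ps≡p′s)
count-cong (refl ∷ ps≡p′s) | false | false = count-cong ps≡p′s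

+count-∧ : ∀ b p σs → + count (λ σ → b ∧ p σ) σs ≡ (if b then + count p σs else 0ℤ)
+count-∧ true  p σs = refl
+count-∧ false p σs = cong +_ (count-false σs)
  where
  count-false : ∀ σs → count (λ _ → false) σs ≡ 0
  count-false []       = refl
  count-false (_ ∷ σs) = count-false σs

count-prepend : ∀ p L h n → + count p (concatMap (λ v → map (v ∷_) L) (applyUpTo h n))
                          ≡ Σ< n (λ j → + count (λ τ → p (h j ∷ τ)) L)
count-prepend p L h zero    = refl
count-prepend p L h (suc n) = begin
  + count p (map (h 0 ∷_) L ++ rest)
    ≡⟨ cong +_ (count-++ p (map (h 0 ∷_) L) rest) ⟩
  + (count p (map (h 0 ∷_) L) ℕ.+ count p rest)
    ≡⟨ ℤ.pos-+ (count p (map (h 0 ∷_) L)) (count p rest) ⟩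
  + count p (map (h 0 ∷_) L) + + count p rest
    ≡⟨ cong₂ _+_ (cong +_ (count-map p (h 0 ∷_) L)) (count-prepend p L (h ∘ suc) n) ⟩
  Σ< (suc n) (λ j → + count (λ τ → p (h j ∷ τ)) L)
    ∎
  where
  open ≡-Reasoning
  rest = concatMap (λ v → map (v ∷_) L) (applyUpTo (h ∘ suc) n)

count-assignments : ∀ m N p → + count p (assignments m (suc N))
                            ≡ Σ< (suc m) (λ v → + count (λ τ → p (v ∷ τ)) (assignments m N))
count-assignments m N p = count-prepend p (assignments m N) (λ v → v) (suc m)

assignments-valid : ∀ m N → All (λ σ → length σ ≡ N × All (_≤ m) σ) (assignments m N)
assignments-valid m zero    = (refl , []) ∷ []
assignments-valid m (suc N) = concat⁺ (map⁺ (applyUpTo⁺₁ (λ v → v) (suc m) (λ v<1+m →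
  map⁺ (All.map (λ (len , σ≤m) → cong suc len , ℕ.s≤s⁻¹ v<1+m ∷ σ≤m) (assignments-valid m N)))))

lastLE-true : ∀ {B σ} → All (_≤ B) σ → lastLE B σ ≡ true
lastLE-true []                   = refl
lastLE-true (v≤B ∷ [])           = Equivalence.to T-≡ (ℕ.≤⇒≤ᵇ v≤B)
lastLE-true (_ ∷ σ≤B@(_ ∷ _))    = lastLE-true σ≤B

≡ᵇ-+ : ∀ u s k → (u ℕ.+ s ≡ᵇ k) ≡ (u <ᵇ suc k) ∧ (s ≡ᵇ k ∸ u)
≡ᵇ-+ zero    s k       = refl
≡ᵇ-+ (suc u) s zero    = refl
≡ᵇ-+ (suc u) s (suc k) = ≡ᵇ-+ u s k

∧-lcomm : ∀ a b c → a ∧ (b ∧ c) ≡ b ∧ (a ∧ c)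
∧-lcomm true  b c = refl
∧-lcomm false b c = sym (∧-zeroʳ b)

Σ<-if : ∀ n b (f : ℕ → ℤ) → Σ< n (λ w → if b then f w else 0ℤ) ≡ (if b then Σ< n f else 0ℤ)
Σ<-if n true  f = refl
Σ<-if n false f = Σ<-zero n (λ _ _ → refl)

chainSeries-count : ∀ m ds u k →
  + count (λ τ → isChain ds (u ∷ τ) ∧ (u ℕ.+ sum τ ≡ᵇ k)) (assignments m (length ds)) ≡ chainSeries m ds u k
chainSeries-count m [] u k rewrite ℕ.+-identityʳ u with u ≡ᵇ k
... | true  = refl
... | false = refl
chainSeries-count m (d ∷ ds) u k = begin
  + count (λ τ → isChain (d ∷ ds) (u ∷ τ) ∧ (u ℕ.+ sum τ ≡ᵇ k)) (assignments m (suc (length ds)))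
    ≡⟨ count-assignments m (length ds) _ ⟩
  Σ< (suc m) (λ w → + count (λ τ → (stepOK d u w ∧ isChain ds (w ∷ τ)) ∧ (u ℕ.+ sum (w ∷ τ) ≡ᵇ k)) A)
    ≡⟨ Σ<-cong (suc m) (λ w _ → shift w) ⟩
  Σ< (suc m) (λ w → if u <ᵇ suc k then when (stepOK d u w) (chainSeries m ds w) (k ∸ u) else 0ℤ)
    ≡⟨ Σ<-if (suc m) (u <ᵇ suc k) (λ w → when (stepOK d u w) (chainSeries m ds w) (k ∸ u)) ⟩
  (if u <ᵇ suc k then nextSum m d u (chainSeries m ds) (k ∸ u) else 0ℤ)
    ≡⟨ q^-⊛ u (nextSum m d u (chainSeries m ds)) k ⟨
  chainSeries m (d ∷ ds) u k
    ∎
  where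
  open ≡-Reasoning
  A = assignments m (length ds)
  shift : ∀ w → + count (λ τ → (stepOK d u w ∧ isChain ds (w ∷ τ)) ∧ (u ℕ.+ sum (w ∷ τ) ≡ᵇ k)) A
              ≡ (if u <ᵇ suc k then when (stepOK d u w) (chainSeries m ds w) (k ∸ u) else 0ℤ)
  shift w = begin
    + count (λ τ → (a ∧ isChain ds (w ∷ τ)) ∧ (u ℕ.+ sum (w ∷ τ) ≡ᵇ k)) A
      ≡⟨ cong +_ (count-cong (All.universal (λ τ → shuffle a (isChain ds (w ∷ τ)) (sum (w ∷ τ))) A)) ⟩
    + count (λ τ → (u <ᵇ suc k) ∧ (a ∧ (isChain ds (w ∷ τ) ∧ (sum (w ∷ τ) ≡ᵇ k ∸ u)))) A
      ≡⟨ +count-∧ (u <ᵇ suc k) _ A ⟩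
    (if u <ᵇ suc k then + count (λ τ → a ∧ (isChain ds (w ∷ τ) ∧ (sum (w ∷ τ) ≡ᵇ k ∸ u))) A else 0ℤ)
      ≡⟨ cong (λ z → if u <ᵇ suc k then z else 0ℤ)
              (trans (+count-∧ a _ A) (cong (λ z → if a then z else 0ℤ) (chainSeries-count m ds w (k ∸ u)))) ⟩
    (if u <ᵇ suc k then when a (chainSeries m ds w) (k ∸ u) else 0ℤ)
      ∎
    where
    a = stepOK d u w
    shuffle : ∀ a c s → (a ∧ c) ∧ (u ℕ.+ s ≡ᵇ k) ≡ (u <ᵇ suc k) ∧ (a ∧ (c ∧ (s ≡ᵇ k ∸ u)))
    shuffle a c s = begin
      (a ∧ c) ∧ (u ℕ.+ s ≡ᵇ k)                  ≡⟨ cong ((a ∧ c) ∧_) (≡ᵇ-+ u s k) ⟩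
      (a ∧ c) ∧ ((u <ᵇ suc k) ∧ (s ≡ᵇ k ∸ u))   ≡⟨ ∧-lcomm (a ∧ c) (u <ᵇ suc k) _ ⟩
      (u <ᵇ suc k) ∧ ((a ∧ c) ∧ (s ≡ᵇ k ∸ u))   ≡⟨ cong ((u <ᵇ suc k) ∧_) (∧-assoc a c _) ⟩
      (u <ᵇ suc k) ∧ (a ∧ (c ∧ (s ≡ᵇ k ∸ u)))   ∎

length-walk : ∀ p ds → length (walk p ds) ≡ suc (length ds)
length-walk p             []           = refl
length-walk (x , y) (true  ∷ ds) = cong suc (length-walk (x , suc y) ds)
length-walk (x , y) (false ∷ ds) = cong suc (length-walk (suc x , y) ds)

boxes≡walk : ∀ as → 2 ≤ sum as → boxes as ≡ walk (0 , 0) (steps as)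
boxes≡walk as 2≤Σ with sum as ∸ 1 in eq
... | zero  = ⊥-elim (ℕ.<⇒≢ (ℕ.∸-monoˡ-< 2≤Σ ℕ.z<s) (sym eq))
... | suc _ = refl

≤ᵇ-suc : ∀ u B → (suc u ≤ᵇ suc B) ≡ (u ≤ᵇ B)
≤ᵇ-suc zero    B = refl
≤ᵇ-suc (suc u) B = refl

Σ<-truncate : ∀ n B (f : ℕ → ℤ) → B < n → Σ< n (λ u → if u ≤ᵇ B then f u else 0ℤ) ≡ Σ< (suc B) f
Σ<-truncate (suc n) zero    f _ = cong (_+_ (f 0)) (Σ<-zero n (λ _ _ → refl))
Σ<-truncate (suc n) (suc B) f (s≤s B<n) = cong (_+_ (f 0)) (begin
  Σ< n (λ u → if suc u ≤ᵇ suc B then f (suc u) else 0ℤ)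
    ≡⟨ Σ<-cong n (λ u _ → cong (λ b → if b then f (suc u) else 0ℤ) (≤ᵇ-suc u B)) ⟩
  Σ< n (λ u → if u ≤ᵇ B then f (suc u) else 0ℤ)
    ≡⟨ Σ<-truncate n B (f ∘ suc) B<n ⟩
  Σ< (suc B) (f ∘ suc)
    ∎)
  where open ≡-Reasoning

count-walk : ∀ m ds B k → B ≤ m →
  + count (λ σ → isPPartition (walk (0 , 0) ds) σ ∧ firstLE B σ ∧ lastLE m σ ∧ (sum σ ≡ᵇ k))
          (assignments m (length (walk (0 , 0) ds)))
  ≡ Σ< (suc B) (λ u → chainSeries m ds u k)
count-walk m ds B k B≤m rewrite length-walk (0 , 0) ds = begin
  + count (λ σ → isPPartition (walk (0 , 0) ds) σ ∧ firstLE B σ ∧ lastLE m σ ∧ (sum σ ≡ᵇ k)) A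
    ≡⟨ cong +_ (count-cong (All.map chain-first (assignments-valid m (suc (length ds))))) ⟩
  + count (λ σ → firstLE B σ ∧ (isChain ds σ ∧ (sum σ ≡ᵇ k))) A
    ≡⟨ count-assignments m (length ds) _ ⟩
  Σ< (suc m) (λ u → + count (λ τ → (u ≤ᵇ B) ∧ chain u τ) (assignments m (length ds)))
    ≡⟨ Σ<-cong (suc m) (λ u _ → trans (+count-∧ (u ≤ᵇ B) (chain u) (assignments m (length ds)))
                                      (cong (λ z → if u ≤ᵇ B then z else 0ℤ) (chainSeries-count m ds u k))) ⟩
  Σ< (suc m) (λ u → if u ≤ᵇ B then chainSeries m ds u k else 0ℤ)
    ≡⟨ Σ<-truncate (suc m) B (λ u → chainSeries m ds u k) (s≤s B≤m) ⟩
  Σ< (suc B) (λ u → chainSeries m ds u k)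
    ∎
  where
  open ≡-Reasoning
  A = assignments m (suc (length ds))
  chain : ℕ → List ℕ → Bool
  chain u τ = isChain ds (u ∷ τ) ∧ (u ℕ.+ sum τ ≡ᵇ k)
  chain-first : ∀ {σ} → length σ ≡ suc (length ds) × All (_≤ m) σ →
    (isPPartition (walk (0 , 0) ds) σ ∧ firstLE B σ ∧ lastLE m σ ∧ (sum σ ≡ᵇ k))
    ≡ firstLE B σ ∧ (isChain ds σ ∧ (sum σ ≡ᵇ k))
  chain-first {σ} (len , σ≤m)
    rewrite isPPartition-walk 0 0 ds σ len | lastLE-true σ≤m = ∧-lcomm (isChain ds σ) (firstLE B σ) _

Ωcoeff-chainSeries : ∀ m I as → 2 ≤ sum as → suc m ∸ I ≤ m →
                     (λ k → + Ωcoeff m I 1 as k) ≗ Σ<ˢ (suc (suc m ∸ I)) (chainSeries m (steps as))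
Ωcoeff-chainSeries m I as 2≤Σ B≤m k rewrite boxes≡walk as 2≤Σ = count-walk m (steps as) (suc m ∸ I) k B≤m

-- The exchange relation

chainSeries-suc-0 : ∀ m ds w → chainSeries m ds (suc w) 0 ≡ 0ℤ
chainSeries-suc-0 m []       w = refl
chainSeries-suc-0 m (d ∷ ds) w = q^suc-⊛-zero w (nextSum m d (suc w) (chainSeries m ds))

chainSeries-0-0 : ∀ m ds → chainSeries m ds 0 0 ≡ 1ℤ
chainSeries-0-0 m []       = refl
chainSeries-0-0 m (d ∷ ds) = begin
  (q^ 0 ⊛ nextSum m d 0 (chainSeries m ds)) 0
    ≡⟨ q^0-⊛ (nextSum m d 0 (chainSeries m ds)) 0 ⟩
  when (stepOK d 0 0) (chainSeries m ds 0) 0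
    + Σ< m (λ w → when (stepOK d 0 (suc w)) (chainSeries m ds (suc w)) 0)
    ≡⟨ cong₂ _+_ (first d) (Σ<-zero m (λ w _ → rest (stepOK d 0 (suc w)) w)) ⟩
  1ℤ + 0ℤ
    ≡⟨⟩
  1ℤ
    ∎
  where
  open ≡-Reasoning
  first : ∀ d → when (stepOK d 0 0) (chainSeries m ds 0) 0 ≡ 1ℤ
  first true  = chainSeries-0-0 m ds
  first false = chainSeries-0-0 m ds
  rest : ∀ b w → when b (chainSeries m ds (suc w)) 0 ≡ 0ℤ
  rest true  w = chainSeries-suc-0 m ds w
  rest false w = refl

chainSeries-right-≈0 : ∀ m r w → 1 ≤ w → chainSeries m (replicate r false) w ≈[ suc r ] 0ˢ
chainSeries-right-≈0 m zero    (suc w) _   zero    _           = refl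
chainSeries-right-≈0 m zero    (suc w) _   (suc k) (s≤s ())
chainSeries-right-≈0 m (suc r) w       1≤w = ≈-weaken (ℕ.+-monoˡ-≤ (suc r) 1≤w) (≈-trans
  (q^-⊛-≈ w (Σ<ˢ-≈0 (suc m) _ (λ z _ → when-≈0 (w ≤ᵇ z) (chainSeries m (replicate r false) z)
     (λ w≤z → chainSeries-right-≈0 m r z (ℕ.≤-trans 1≤w (ℕ.≤ᵇ⇒≤ w z w≤z))))))
  (≗⇒≈ (w ℕ.+ suc r) (⊛-zeroʳ (q^ w))))

nextSum-up-≈ : ∀ {K} m u f → (∀ w → f (suc w) ≈[ K ] 0ˢ) → nextSum m true u f ≈[ K ] f 0
nextSum-up-≈ m u f f≈0 = Σ<ˢ-≈-head m (λ w → when (w ≤ᵇ u) (f w))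
  (λ w _ → when-≈0 (suc w ≤ᵇ u) (f (suc w)) (λ _ → f≈0 w))

≢⇒1≤+ : ∀ {u v} → u ≢ v → 1 ≤ u ℕ.+ v
≢⇒1≤+ {zero}  {zero}  u≢v = ⊥-elim (u≢v refl)
≢⇒1≤+ {zero}  {suc v} _   = s≤s z≤n
≢⇒1≤+ {suc u} {v}     _   = s≤s z≤n

q^-q^-⊛-≈ : ∀ {K f g} u v → u ≢ v → f ≈[ K ] g → q^ u ⊛ (q^ v ⊛ f) ≈[ suc K ] q^ u ⊛ (q^ v ⊛ g)
q^-q^-⊛-≈ {K} u v u≢v f≈g = ≈-weaken
  (subst (suc K ≤_) (ℕ.+-assoc u v K) (ℕ.+-monoˡ-≤ K (≢⇒1≤+ u≢v)))
  (q^-⊛-≈ u (q^-⊛-≈ v f≈g))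

Σ<ˢ-⊛-Σ<ˢ-≈ : ∀ {K} n p F F′ G G′ → (∀ w z → F w ⊛ G z ≈[ K ] F′ w ⊛ G′ z) →
              Σ<ˢ n F ⊛ Σ<ˢ p G ≈[ K ] Σ<ˢ n F′ ⊛ Σ<ˢ p G′
Σ<ˢ-⊛-Σ<ˢ-≈ {K} n p F F′ G G′ FG≈F′G′ = Σ<ˢ-⊛-≈ n F F′ (Σ<ˢ p G) (Σ<ˢ p G′) (λ w → begin
  F w ⊛ Σ<ˢ p G     ≈⟨ ≗⇒≈ K (⊛-comm (F w) (Σ<ˢ p G)) ⟩
  Σ<ˢ p G ⊛ F w     ≈⟨ Σ<ˢ-⊛-≈ p G G′ (F w) (F′ w) (λ z → begin
      G z ⊛ F w         ≈⟨ ≗⇒≈ K (⊛-comm (G z) (F w)) ⟩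
      F w ⊛ G z         ≈⟨ FG≈F′G′ w z ⟩
      F′ w ⊛ G′ z       ≈⟨ ≗⇒≈ K (⊛-comm (F′ w) (G′ z)) ⟩
      G′ z ⊛ F′ w       ∎) ⟩
  Σ<ˢ p G′ ⊛ F′ w   ≈⟨ ≗⇒≈ K (⊛-comm (Σ<ˢ p G′) (F′ w)) ⟩
  F′ w ⊛ Σ<ˢ p G′   ∎)
  where open ≈-Reasoning K

nextSum-⊛-≈ : ∀ {K} m d u v f f′ g g′ → (∀ w z → f w ⊛ g z ≈[ K ] f′ w ⊛ g′ z) →
              nextSum m d u f ⊛ nextSum m d v g ≈[ K ] nextSum m d u f′ ⊛ nextSum m d v g′
nextSum-⊛-≈ m d u v f f′ g g′ fg≈f′g′ = Σ<ˢ-⊛-Σ<ˢ-≈ (suc m) (suc m)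
  (λ w → when (stepOK d u w) (f w)) (λ w → when (stepOK d u w) (f′ w))
  (λ z → when (stepOK d v z) (g z)) (λ z → when (stepOK d v z) (g′ z))
  (λ w z → when-⊛-≈ (stepOK d u w) (stepOK d v z) (f w) (g z) (f′ w) (g′ z) (fg≈f′g′ w z))

chainSeries-++-≈ : ∀ m X K → (∀ u v → chainSeries m X u ⊛ q^ v ≈[ K ] q^ u ⊛ chainSeries m X v) →
  ∀ ds u v → chainSeries m (ds ++ X) u ⊛ chainSeries m ds v
             ≈[ length ds ℕ.+ K ] chainSeries m ds u ⊛ chainSeries m (ds ++ X) v
chainSeries-++-≈ m X K base []       u v = base u v
chainSeries-++-≈ m X K base (d ∷ ds) u v with u ℕ.≟ v
... | yes refl = ≗⇒≈ _ (⊛-comm (chainSeries m (d ∷ ds ++ X) u) (chainSeries m (d ∷ ds) u))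
... | no u≢v   = begin
  (q^ u ⊛ next u Fˣ) ⊛ (q^ v ⊛ next v F)   ≈⟨ ≗⇒≈ _ (⊛-interchange (q^ u) (next u Fˣ) (q^ v) (next v F)) ⟩
  q^ u ⊛ (q^ v ⊛ (next u Fˣ ⊛ next v F))   ≈⟨ q^-q^-⊛-≈ u v u≢v (nextSum-⊛-≈ m d u v Fˣ F F Fˣ
                                                 (chainSeries-++-≈ m X K base ds)) ⟩
  q^ u ⊛ (q^ v ⊛ (next u F ⊛ next v Fˣ))   ≈⟨ ≗⇒≈ _ (⊛-interchange (q^ u) (next u F) (q^ v) (next v Fˣ)) ⟨
  (q^ u ⊛ next u F) ⊛ (q^ v ⊛ next v Fˣ)   ∎
  where
  open ≈-Reasoning (suc (length ds ℕ.+ K))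
  F Fˣ : ℕ → Series
  F  = chainSeries m ds
  Fˣ = chainSeries m (ds ++ X)
  next : ℕ → (ℕ → Series) → Series
  next u = nextSum m d u

chainSeries-∷-≈ : ∀ m d R K →
  (∀ u v → nextSum m d u (chainSeries m R) ≈[ K ] nextSum m d v (chainSeries m R)) →
  ∀ u v → chainSeries m (d ∷ R) u ⊛ q^ v ≈[ suc K ] q^ u ⊛ chainSeries m (d ∷ R) v
chainSeries-∷-≈ m d R K next≈ u v with u ℕ.≟ v
... | yes refl = ≗⇒≈ _ (⊛-comm (chainSeries m (d ∷ R) u) (q^ u))
... | no u≢v   = begin
  (q^ u ⊛ next u) ⊛ q^ v        ≈⟨ ≗⇒≈ _ (λ k → trans (⊛-assoc (q^ u) (next u) (q^ v) k)
                                                      (⊛-congʳ (q^ u) (⊛-comm (next u) (q^ v)) k)) ⟩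
  q^ u ⊛ (q^ v ⊛ next u)        ≈⟨ q^-q^-⊛-≈ u v u≢v (next≈ u v) ⟩
  q^ u ⊛ (q^ v ⊛ next v)        ∎
  where
  open ≈-Reasoning (suc K)
  next : ℕ → Series
  next u = nextSum m d u (chainSeries m R)

-- Step sequences of convergents

-- Appending c to as lengthens the last run of G[as] by one step and adds c − 1 steps in the
-- other direction.
newRun : Bool → ℕ → List Bool
newRun d c = d ∷ replicate (c ∸ 1) (not d)

lastRunDirection : Bool → List ℕ → Bool
lastRunDirection d []           = d
lastRunDirection d (_ ∷ [])     = d
lastRunDirection d (_ ∷ b ∷ as) = lastRunDirection (not d) (b ∷ as)

replicate-suc-++ : ∀ n (x : Bool) ys → replicate (suc n) x ++ ys ≡ replicate n x ++ x ∷ ys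
replicate-suc-++ zero    x ys = refl
replicate-suc-++ (suc n) x ys = cong (x ∷_) (replicate-suc-++ n x ys)

tailSteps-∷ʳ : ∀ d b as c → All (1 ≤_) (b ∷ as) →
               tailSteps d ((b ∷ as) ∷ʳ c) ≡ tailSteps d (b ∷ as) ++ newRun (lastRunDirection d (b ∷ as)) c
tailSteps-∷ʳ d (suc b) []       c _          = replicate-suc-++ b d (replicate (c ∸ 1) (not d))
tailSteps-∷ʳ d b       (b′ ∷ as) c (_ ∷ pos) = trans
  (cong (replicate b d ++_) (tailSteps-∷ʳ (not d) b′ as c pos))
  (sym (++-assoc (replicate b d) (tailSteps (not d) (b′ ∷ as)) _))

steps-∷ʳ : ∀ as c → All (1 ≤_) as → 2 ≤ sum as →
           steps (as ∷ʳ c) ≡ steps as ++ newRun (lastRunDirection true as) c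
steps-∷ʳ (suc (suc a) ∷ []) c _         _ = replicate-suc-++ a true (replicate (c ∸ 1) false)
steps-∷ʳ (suc zero ∷ [])    c _         (s≤s ())
steps-∷ʳ (a ∷ b ∷ as)       c (_ ∷ pos) _ = trans
  (cong (replicate (a ∸ 1) true ++_) (tailSteps-∷ʳ false b as c pos))
  (sym (++-assoc (replicate (a ∸ 1) true) (tailSteps false (b ∷ as)) _))

length-tailSteps : ∀ d b as → All (1 ≤_) (b ∷ as) → suc (length (tailSteps d (b ∷ as))) ≡ sum (b ∷ as)
length-tailSteps d b []        (1≤b ∷ _) = begin
  suc (length (replicate (b ∸ 1) d))   ≡⟨ cong suc (length-replicate (b ∸ 1)) ⟩
  suc (b ∸ 1)                          ≡⟨ ℕ.m+[n∸m]≡n 1≤b ⟩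
  b                                    ≡⟨ ℕ.+-identityʳ b ⟨
  b ℕ.+ 0                              ∎
  where open ≡-Reasoning
length-tailSteps d b (b′ ∷ as) (_ ∷ pos) = begin
  suc (length (replicate b d ++ tailSteps (not d) (b′ ∷ as)))
    ≡⟨ cong suc (length-++ (replicate b d)) ⟩
  suc (length (replicate b d) ℕ.+ length (tailSteps (not d) (b′ ∷ as)))
    ≡⟨ cong (λ l → suc (l ℕ.+ _)) (length-replicate b) ⟩
  suc (b ℕ.+ length (tailSteps (not d) (b′ ∷ as)))
    ≡⟨ ℕ.+-suc b _ ⟨
  b ℕ.+ suc (length (tailSteps (not d) (b′ ∷ as)))
    ≡⟨ cong (b ℕ.+_) (length-tailSteps (not d) b′ as pos) ⟩
  b ℕ.+ sum (b′ ∷ as)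
    ∎
  where open ≡-Reasoning

sum≡2+length-steps : ∀ as → All (1 ≤_) as → 2 ≤ sum as → sum as ≡ 2 ℕ.+ length (steps as)
sum≡2+length-steps (suc (suc a) ∷ []) _         _ =
  cong (2 ℕ.+_) (trans (ℕ.+-identityʳ a) (sym (length-replicate a)))
sum≡2+length-steps (suc zero ∷ [])    _         (s≤s ())
sum≡2+length-steps (a ∷ b ∷ as)       (1≤a ∷ pos) _ = begin
  a ℕ.+ sum (b ∷ as)
    ≡⟨ cong₂ ℕ._+_ (ℕ.m+[n∸m]≡n 1≤a) (length-tailSteps false b as pos) ⟨
  suc (a ∸ 1) ℕ.+ suc (length (tailSteps false (b ∷ as)))
    ≡⟨ cong suc (ℕ.+-suc (a ∸ 1) _) ⟩
  2 ℕ.+ ((a ∸ 1) ℕ.+ length (tailSteps false (b ∷ as)))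
    ≡⟨ cong (λ l → 2 ℕ.+ (l ℕ.+ _)) (length-replicate (a ∸ 1)) ⟨
  2 ℕ.+ (length (replicate (a ∸ 1) true) ℕ.+ length (tailSteps false (b ∷ as)))
    ≡⟨ cong (2 ℕ.+_) (length-++ (replicate (a ∸ 1) true)) ⟨
  2 ℕ.+ length (steps (a ∷ b ∷ as))
    ∎
  where open ≡-Reasoning

sum-∷ʳ : ∀ as c → sum (as ∷ʳ c) ≡ sum as ℕ.+ c
sum-∷ʳ as c = trans (sum-++ as (c ∷ [])) (cong (sum as ℕ.+_) (ℕ.+-identityʳ c))

2≤sum-∷ʳ : ∀ as c → 2 ≤ sum as → 2 ≤ sum (as ∷ʳ c)
2≤sum-∷ʳ as c 2≤Σ = subst (2 ≤_) (sym (sum-∷ʳ as c)) (ℕ.≤-trans 2≤Σ (ℕ.m≤m+n (sum as) c))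

lastRunDirection-even : ∀ d as → suc (length as) % 2 ≡ 0 → lastRunDirection d as ≡ d
lastRunDirection-even d []               _    = refl
lastRunDirection-even d (_ ∷ [])         _    = refl
lastRunDirection-even d (_ ∷ _ ∷ [])     ()
lastRunDirection-even d (_ ∷ _ ∷ c ∷ as) even =
  trans (lastRunDirection-even (not (not d)) (c ∷ as) even) (not-involutive d)

-- Consecutive convergents

module _ {m i : ℕ} (i≤m : i ≤ m) where

  numerator denominator : List ℕ → Series
  numerator   as k = + Ωcoeff m (suc m ∸ i) 1 as k
  denominator as k = + Ωcoeff m (suc m) 1 as k

  numerator-chainSeries : ∀ as → 2 ≤ sum as → numerator as ≗ Σ<ˢ (suc i) (chainSeries m (steps as))
  numerator-chainSeries as 2≤Σ k = trans
    (Ωcoeff-chainSeries m (suc m ∸ i) as 2≤Σ (subst (_≤ m) (sym bound≡i) i≤m) k)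
    (cong (λ b → Σ<ˢ (suc b) (chainSeries m (steps as)) k) bound≡i)
    where
    bound≡i : suc m ∸ (suc m ∸ i) ≡ i
    bound≡i = ℕ.m∸[m∸n]≡n (ℕ.m≤n⇒m≤1+n i≤m)

  denominator-chainSeries : ∀ as → 2 ≤ sum as → denominator as ≗ chainSeries m (steps as) 0
  denominator-chainSeries as 2≤Σ k = begin
    denominator as k
      ≡⟨ Ωcoeff-chainSeries m (suc m) as 2≤Σ (ℕ.m∸n≤m m m) k ⟩
    Σ<ˢ (suc (m ∸ m)) (chainSeries m (steps as)) k
      ≡⟨ cong (λ b → Σ<ˢ (suc b) (chainSeries m (steps as)) k) (ℕ.n∸n≡0 m) ⟩
    chainSeries m (steps as) 0 k + 0ℤ
      ≡⟨ ℤ.+-identityʳ _ ⟩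
    chainSeries m (steps as) 0 k
      ∎
    where open ≡-Reasoning

  denominator-0 : ∀ as → 2 ≤ sum as → denominator as 0 ≡ 1ℤ
  denominator-0 as 2≤Σ = trans (denominator-chainSeries as 2≤Σ 0) (chainSeries-0-0 m (steps as))

  rCoeff-++-≈ : ∀ as₁ as₂ X K → 2 ≤ sum as₁ → 2 ≤ sum as₂ → steps as₁ ≡ steps as₂ ++ X →
                (∀ u v → chainSeries m X u ⊛ q^ v ≈[ K ] q^ u ⊛ chainSeries m X v) →
                rCoeff i m as₁ ≈[ length (steps as₂) ℕ.+ K ] rCoeff i m as₂
  rCoeff-++-≈ as₁ as₂ X K 2≤Σ₁ 2≤Σ₂ steps≡ base = seriesCoeff-≈
    (numerator as₁) (denominator as₁) (numerator as₂) (denominator as₂)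
    (denominator-0 as₁ 2≤Σ₁) (denominator-0 as₂ 2≤Σ₂) (begin
      denominator as₂ ⊛ numerator as₁    ≈⟨ ≗⇒≈ K′ (⊛-cong (denominator-chainSeries as₂ 2≤Σ₂) numerator₁≗) ⟩
      F 0 ⊛ Σ<ˢ (suc i) Fˣ               ≈⟨ ≗⇒≈ K′ (⊛-comm (F 0) (Σ<ˢ (suc i) Fˣ)) ⟩
      Σ<ˢ (suc i) Fˣ ⊛ F 0               ≈⟨ Σ<ˢ-⊛-≈ (suc i) Fˣ F (F 0) (Fˣ 0)
                                              (λ u → chainSeries-++-≈ m X K base (steps as₂) u 0) ⟩
      Σ<ˢ (suc i) F ⊛ Fˣ 0               ≈⟨ ≗⇒≈ K′ (⊛-comm (Σ<ˢ (suc i) F) (Fˣ 0)) ⟩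
      Fˣ 0 ⊛ Σ<ˢ (suc i) F               ≈⟨ ≗⇒≈ K′ (⊛-cong denominator₁≗ (numerator-chainSeries as₂ 2≤Σ₂)) ⟨
      denominator as₁ ⊛ numerator as₂    ∎)
    where
    K′ = length (steps as₂) ℕ.+ K
    open ≈-Reasoning K′
    F Fˣ : ℕ → Series
    F  = chainSeries m (steps as₂)
    Fˣ = chainSeries m (steps as₂ ++ X)
    numerator₁≗ : numerator as₁ ≗ Σ<ˢ (suc i) Fˣ
    numerator₁≗ k = trans (numerator-chainSeries as₁ 2≤Σ₁ k)
                          (cong (λ ds → Σ<ˢ (suc i) (chainSeries m ds) k) steps≡)
    denominator₁≗ : denominator as₁ ≗ Fˣ 0
    denominator₁≗ k = trans (denominator-chainSeries as₁ 2≤Σ₁ k)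
                            (cong (λ ds → chainSeries m ds 0 k) steps≡)

  -- G[1] has no boxes, so both of its series are 1.
  rCoeff-1∷-≈ : ∀ r → rCoeff i m (1 ∷ suc r ∷ []) ≈[ suc r ] rCoeff i m (1 ∷ [])
  rCoeff-1∷-≈ r = seriesCoeff-≈
    (numerator as) (denominator as) (numerator (1 ∷ [])) (denominator (1 ∷ []))
    (denominator-0 as 2≤Σ) refl (begin
      denominator (1 ∷ []) ⊛ numerator as
        ≈⟨ ≗⇒≈ (suc r) (⊛-cong (empty (suc m)) (numerator-chainSeries as 2≤Σ)) ⟩
      q^ 0 ⊛ Σ<ˢ (suc i) F
        ≈⟨ ≗⇒≈ (suc r) (q^0-⊛ (Σ<ˢ (suc i) F)) ⟩
      Σ<ˢ (suc i) F
        ≈⟨ Σ<ˢ-≈-head i F (λ w _ → chainSeries-right-≈0 m r (suc w) (s≤s z≤n)) ⟩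
      F 0
        ≈⟨ ≗⇒≈ (suc r) (λ k → trans (⊛-comm (F 0) (q^ 0) k) (q^0-⊛ (F 0) k)) ⟨
      F 0 ⊛ q^ 0
        ≈⟨ ≗⇒≈ (suc r) (⊛-cong (denominator-chainSeries as 2≤Σ) (empty (suc m ∸ i))) ⟨
      denominator as ⊛ numerator (1 ∷ [])
        ∎)
    where
    open ≈-Reasoning (suc r)
    as = 1 ∷ suc r ∷ []
    2≤Σ : 2 ≤ sum as
    2≤Σ = s≤s (s≤s z≤n)
    F : ℕ → Series
    F = chainSeries m (replicate r false)
    empty : ∀ I → (λ k → + Ωcoeff m I 1 (1 ∷ []) k) ≗ q^ 0
    empty I zero    = refl
    empty I (suc k) = refl

  rCoeff-∷ʳ-≈ : ∀ as c → All (1 ≤_) as → rCoeff i m (as ∷ʳ c) ≈[ sum as ∸ 1 ] rCoeff i m as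
  rCoeff-∷ʳ-≈ as c pos with 2 ℕ.≤? sum as
  ... | no  2≰Σ = ≈-weaken (ℕ.≤-reflexive (ℕ.m≤n⇒m∸n≡0 (ℕ.s≤s⁻¹ (ℕ.≰⇒> 2≰Σ)))) (≈-zero _ _)
  ... | yes 2≤Σ = ≈-weaken (ℕ.≤-reflexive bound) (rCoeff-++-≈ (as ∷ʳ c) as (newRun d c) 1
      (2≤sum-∷ʳ as c 2≤Σ) 2≤Σ (steps-∷ʳ as c pos 2≤Σ)
      (chainSeries-∷-≈ m d (replicate (c ∸ 1) (not d)) 0 (λ _ _ → ≈-zero _ _)))
    where
    d = lastRunDirection true as
    bound : sum as ∸ 1 ≡ length (steps as) ℕ.+ 1
    bound = trans (cong (_∸ 1) (sum≡2+length-steps as pos 2≤Σ)) (ℕ.+-comm 1 (length (steps as)))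

  rCoeff-∷ʳ-up-≈ : ∀ as r → All (1 ≤_) as → 2 ≤ sum as → lastRunDirection true as ≡ true →
                   rCoeff i m (as ∷ʳ suc r) ≈[ sum (as ∷ʳ suc r) ∸ 1 ] rCoeff i m as
  rCoeff-∷ʳ-up-≈ as r pos 2≤Σ up = ≈-weaken (ℕ.≤-reflexive bound) (rCoeff-++-≈ (as ∷ʳ suc r) as
      (newRun true (suc r)) (suc (suc r)) (2≤sum-∷ʳ as (suc r) 2≤Σ) 2≤Σ
      (subst (λ d → steps (as ∷ʳ suc r) ≡ steps as ++ newRun d (suc r)) up (steps-∷ʳ as (suc r) pos 2≤Σ))
      (chainSeries-∷-≈ m true (replicate r false) (suc r) (λ u v →
         ≈-trans (nextSum-up-≈ m u F right-≈0) (≈-sym (nextSum-up-≈ m v F right-≈0)))))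
    where
    F : ℕ → Series
    F = chainSeries m (replicate r false)
    right-≈0 : ∀ w → F (suc w) ≈[ suc r ] 0ˢ
    right-≈0 w = chainSeries-right-≈0 m r (suc w) (s≤s z≤n)
    bound : sum (as ∷ʳ suc r) ∸ 1 ≡ length (steps as) ℕ.+ suc (suc r)
    bound = begin
      sum (as ∷ʳ suc r) ∸ 1                        ≡⟨ cong (_∸ 1) (sum-∷ʳ as (suc r)) ⟩
      sum as ℕ.+ suc r ∸ 1                         ≡⟨ cong (λ s → s ℕ.+ suc r ∸ 1)
                                                           (sum≡2+length-steps as pos 2≤Σ) ⟩
      suc (length (steps as) ℕ.+ suc r)            ≡⟨ ℕ.+-suc (length (steps as)) (suc r) ⟨
      length (steps as) ℕ.+ suc (suc r)            ∎
      where open ≡-Reasoning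

  rCoeff-∷ʳ-even-≈ : ∀ as c → All (1 ≤_) as → 1 ≤ c → suc (length as) % 2 ≡ 0 →
                     rCoeff i m (as ∷ʳ c) ≈[ sum (as ∷ʳ c) ∸ 1 ] rCoeff i m as
  rCoeff-∷ʳ-even-≈ []                  _       _   _ ()
  rCoeff-∷ʳ-even-≈ (zero ∷ [])         _       (() ∷ _)
  rCoeff-∷ʳ-even-≈ (suc zero ∷ [])     (suc r) _   _ _    =
    ≈-weaken (ℕ.≤-reflexive (ℕ.+-identityʳ (suc r))) (rCoeff-1∷-≈ r)
  rCoeff-∷ʳ-even-≈ as@(suc (suc _) ∷ []) (suc r) pos _ even =
    rCoeff-∷ʳ-up-≈ as r pos (s≤s (s≤s z≤n)) (lastRunDirection-even true as even)
  rCoeff-∷ʳ-even-≈ as@(a ∷ b ∷ _)     (suc r) pos@(1≤a ∷ 1≤b ∷ _) _ even =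
    rCoeff-∷ʳ-up-≈ as r pos (ℕ.+-mono-≤ 1≤a (ℕ.≤-trans 1≤b (ℕ.m≤m+n b _)))
                   (lastRunDirection-even true as even)

convergent-suc : ∀ a n → convergent a (suc n) ≡ convergent a n ∷ʳ a n
convergent-suc a n = begin
  map a (upTo (suc n))      ≡⟨ map-upTo a (suc n) ⟩
  applyUpTo a (suc n)       ≡⟨ applyUpTo-∷ʳ a n ⟨
  applyUpTo a n ∷ʳ a n      ≡⟨ cong (_∷ʳ a n) (map-upTo a n) ⟨
  map a (upTo n) ∷ʳ a n     ∎
  where open ≡-Reasoning

theoremB : (m i : ℕ) → 1 ≤ m → i ≤ m →
    (a : ℕ → ℕ) → (∀ k → 1 ≤ a k) →
    (n : ℕ) → 2 ≤ n →
      (n % 2 ≡ 0 → ∀ k → k < sum (convergent a n) ∸ 1 →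
         rCoeff i m (convergent a n) k ≡ rCoeff i m (convergent a (n ∸ 1)) k)
      ×
      (n % 2 ≡ 1 → ∀ k → k < sum (convergent a (n ∸ 1)) ∸ 1 →
         rCoeff i m (convergent a n) k ≡ rCoeff i m (convergent a (n ∸ 1)) k)
theoremB m i _ i≤m a pos zero    ()
theoremB m i _ i≤m a pos (suc n) _ =
    (λ even → from-∷ʳ (λ as′ → sum as′ ∸ 1)
       (rCoeff-∷ʳ-even-≈ i≤m as (a n) positive (pos n) (subst (λ l → suc l % 2 ≡ 0) (sym length≡n) even)))
  , (λ _ → from-∷ʳ (λ _ → sum as ∸ 1) (rCoeff-∷ʳ-≈ i≤m as (a n) positive))
  where
  as = convergent a n
  from-∷ʳ : ∀ K → rCoeff i m (as ∷ʳ a n) ≈[ K (as ∷ʳ a n) ] rCoeff i m as →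
            rCoeff i m (convergent a (suc n)) ≈[ K (convergent a (suc n)) ] rCoeff i m as
  from-∷ʳ K = subst (λ as′ → rCoeff i m as′ ≈[ K as′ ] rCoeff i m as) (sym (convergent-suc a n))
  positive : All (1 ≤_) as
  positive = map⁺ (All.universal pos (upTo n))
  length≡n : length as ≡ n
  length≡n = trans (length-map a (upTo n)) (length-upTo n)
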